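{- Let $\mathcal V$ be a type universe. One can give a nontrivial locally small $\delta_{\mathcal V}$-complete poset with decidable equality if and only if weak excluded middle in $\mathcal V$ holds, i.e. for every proposition $P:\mathcal V$ we have $\neg P+\neg\neg P$.
   Context: Setting: intensional Martin-Löf type theory (univalent foundations) with non-cumulative type universes, function extensionality, propositional extensionality and propositional truncations; excluded middle, choice and resizing are not assumed. A proposition is a type any two of whose elements are equal. A type $Y$ is $\mathcal V$-small if it is equivalent to a type in $\mathcal V$. A poset is a type $X$ with a proposition-valued reflexive, transitive, antisymmetric relation $\sqsubseteq$. It is $\delta_{\mathcal V}$-complete if for all $x\sqsubseteq y$ and every proposition $P:\mathcal V$, the family $\delta_{x,y,P}:\mathbf 1+P\to X$ ($\mathrm{inl}(\star)\mapsto x$, $\mathrm{inr}(p)\mapsto y$) has a least upper bound. It is nontrivial if it comes with specified $x,y$ with $x\sqsubseteq y$ and $x\neq y$; locally small if each $x\sqsubseteq y$ is $\mathcal V$-small. $X$ has decidable equality if $(x=y)+\neg(x=y)$ for all $x,y:X$. -}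

module Defs where

open import Level using (Level; _⊔_; suc)
open import Data.Unit.Polymorphic using (⊤; tt)
open import Data.Sum using (_⊎_; inj₁; inj₂)
open import Data.Product using (Σ; _×_; _,_)
open import Relation.Nullary using (¬_; Dec)
open import Relation.Binary.PropositionalEquality using (_≡_)
open import Function.Bundles using (_↔_)

isProp : ∀ {ℓ} → Set ℓ → Set ℓ
isProp A = (a b : A) → a ≡ b

WEM : (𝓥 : Level) → Set (suc 𝓥)
WEM 𝓥 = (P : Set 𝓥) → isProp P → (¬ P) ⊎ (¬ ¬ P)

-- A type is 𝓥-small if it is equivalent to a type in Set 𝓥.
-- (Equivalence rendered as a bi-invertible map / isomorphism, _↔_.)
isSmall : ∀ {ℓ} (𝓥 : Level) → Set ℓ → Set (ℓ ⊔ suc 𝓥)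
isSmall 𝓥 Y = Σ (Set 𝓥) (λ Y' → Y ↔ Y')

record Poset (𝓤 𝓣 : Level) : Set (suc (𝓤 ⊔ 𝓣)) where
  field
    Carrier   : Set 𝓤
    _⊑_       : Carrier → Carrier → Set 𝓣
    ⊑-prop    : ∀ x y → isProp (x ⊑ y)
    ⊑-refl    : ∀ x → x ⊑ x
    ⊑-trans   : ∀ x y z → x ⊑ y → y ⊑ z → x ⊑ z
    ⊑-antisym : ∀ x y → x ⊑ y → y ⊑ x → x ≡ y

module _ {𝓤 𝓣 : Level} (X : Poset 𝓤 𝓣) where
  open Poset X

  isSup : ∀ {ℓ} {I : Set ℓ} → (I → Carrier) → Carrier → Set (ℓ ⊔ 𝓤 ⊔ 𝓣)
  isSup {I = I} α s =
    ((i : I) → α i ⊑ s) × ((u : Carrier) → ((i : I) → α i ⊑ u) → s ⊑ u)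

  hasSup : ∀ {ℓ} {I : Set ℓ} → (I → Carrier) → Set (ℓ ⊔ 𝓤 ⊔ 𝓣)
  hasSup α = Σ Carrier (isSup α)

  δ : ∀ {𝓥} (x y : Carrier) (P : Set 𝓥) → ⊤ {𝓥} ⊎ P → Carrier
  δ x y P (inj₁ _) = x
  δ x y P (inj₂ _) = y

  δ-complete : (𝓥 : Level) → Set (suc 𝓥 ⊔ 𝓤 ⊔ 𝓣)
  δ-complete 𝓥 = (x y : Carrier) → x ⊑ y → (P : Set 𝓥) → isProp P
               → hasSup (δ x y P)

  Nontrivial : Set (𝓤 ⊔ 𝓣)
  Nontrivial = Σ Carrier (λ x → Σ Carrier (λ y → (x ⊑ y) × (¬ (x ≡ y))))

  locallySmall : (𝓥 : Level) → Set (suc 𝓥 ⊔ 𝓤 ⊔ 𝓣)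
  locallySmall 𝓥 = (x y : Carrier) → isSmall 𝓥 (x ⊑ y)

  hasDecidableEquality : Set 𝓤
  hasDecidableEquality = (x y : Carrier) → Dec (x ≡ y)

NTLSδDecPoset : (𝓥 𝓤 𝓣 : Level) → Set (suc (𝓥 ⊔ 𝓤 ⊔ 𝓣))
NTLSδDecPoset 𝓥 𝓤 𝓣 =
  Σ (Poset 𝓤 𝓣) (λ X →
    Nontrivial X × locallySmall X 𝓥 × δ-complete X 𝓥 × hasDecidableEquality X)

-- Let s be the supremum of δ_{x,y,P} for x ⊑ y, x ≠ y. If P holds then
-- y ⊑ s, so s = x refutes P; if ¬ P then x is an upper bound, so s = x.
-- Hence deciding s = x decides ¬ P versus ¬ ¬ P. Conversely, under WEM the
-- two-element poset false ⊑ true is δ-complete: the supremum is x when ¬ P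
-- and y when ¬ ¬ P, the latter because a decidable order is ¬¬-stable.
module Submission where

open import Defs
open import Level using (Level; Lift; lift; lower)
open import Function.Bundles using (_⇔_; mk⇔; mk↔ₛ′)
open import Data.Bool using (Bool; true; false; _≤_; f≤t)
open import Data.Bool.Properties using (_≟_; _≤?_; ≤-refl; ≤-trans; ≤-antisym; ≤-irrelevant)
open import Data.Unit.Polymorphic using (tt)
open import Data.Sum using (inj₁; inj₂)
open import Data.Product using (_,_)
open import Relation.Nullary using (¬_; Dec; yes; no; contradiction)
open import Relation.Nullary.Decidable using (map′; decidable-stable)
open import Relation.Binary.PropositionalEquality using (_≡_; refl; cong; subst)

Lift-isSmall : ∀ (𝓥 : Level) {ℓ} (A : Set) → isSmall 𝓥 (Lift ℓ A)
Lift-isSmall 𝓥 A =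
  Lift 𝓥 A , mk↔ₛ′ (λ a → lift (lower a)) (λ a → lift (lower a)) (λ _ → refl) (λ _ → refl)

module _ {𝓤 𝓣 : Level} (X : Poset 𝓤 𝓣) where
  open Poset X

  δ-sup≡x⇒¬P : ∀ {𝓥} {x y s : Carrier} {P : Set 𝓥} → x ⊑ y → ¬ x ≡ y
             → isSup X (δ X x y P) s → s ≡ x → ¬ P
  δ-sup≡x⇒¬P {x = x} {y} x⊑y x≢y (upper , _) s≡x p =
    x≢y (⊑-antisym x y x⊑y (subst (y ⊑_) s≡x (upper (inj₂ p))))

  ¬P⇒δ-sup≡x : ∀ {𝓥} {x y s : Carrier} {P : Set 𝓥}
             → isSup X (δ X x y P) s → ¬ P → s ≡ x
  ¬P⇒δ-sup≡x {x = x} {s = s} (upper , least) ¬p =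
    ⊑-antisym s x (least x λ { (inj₁ _) → ⊑-refl x ; (inj₂ p) → contradiction p ¬p })
                  (upper (inj₁ tt))

  δ-complete⇒WEM : ∀ {𝓥} → hasDecidableEquality X → δ-complete X 𝓥
                 → (x y : Carrier) → x ⊑ y → ¬ x ≡ y → WEM 𝓥
  δ-complete⇒WEM _≟X_ complete x y x⊑y x≢y P P-prop
    with complete x y x⊑y P P-prop
  ... | s , s-sup with s ≟X x
  ...   | yes s≡x = inj₁ (δ-sup≡x⇒¬P x⊑y x≢y s-sup s≡x)
  ...   | no s≢x  = inj₂ λ ¬p → s≢x (¬P⇒δ-sup≡x s-sup ¬p)

  δ-isSup-x : ∀ {𝓥} (x y : Carrier) {P : Set 𝓥} → ¬ P → isSup X (δ X x y P) x
  δ-isSup-x x y ¬p = (λ { (inj₁ _) → ⊑-refl x ; (inj₂ p) → contradiction p ¬p })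
                   , λ _ upper → upper (inj₁ tt)

  δ-isSup-y : ∀ {𝓥} {x y : Carrier} {P : Set 𝓥} → (∀ u → Dec (y ⊑ u))
            → x ⊑ y → ¬ ¬ P → isSup X (δ X x y P) y
  δ-isSup-y {y = y} y⊑? x⊑y ¬¬p =
    (λ { (inj₁ _) → x⊑y ; (inj₂ _) → ⊑-refl y })
    , λ u upper → decidable-stable (y⊑? u) λ y⋢u → ¬¬p λ p → y⋢u (upper (inj₂ p))

  WEM⇒δ-complete : ∀ {𝓥} → (∀ a b → Dec (a ⊑ b)) → WEM 𝓥 → δ-complete X 𝓥
  WEM⇒δ-complete _⊑?_ wem x y x⊑y P P-prop with wem P P-prop
  ... | inj₁ ¬p  = x , δ-isSup-x x y ¬p
  ... | inj₂ ¬¬p = y , δ-isSup-y (y ⊑?_) x⊑y ¬¬p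

𝟚-poset : (𝓤 𝓣 : Level) → Poset 𝓤 𝓣
𝟚-poset 𝓤 𝓣 = record
  { Carrier   = Lift 𝓤 Bool
  ; _⊑_       = λ a b → Lift 𝓣 (lower a ≤ lower b)
  ; ⊑-prop    = λ _ _ p q → cong lift (≤-irrelevant (lower p) (lower q))
  ; ⊑-refl    = λ _ → lift ≤-refl
  ; ⊑-trans   = λ _ _ _ p q → lift (≤-trans (lower p) (lower q))
  ; ⊑-antisym = λ _ _ p q → cong lift (≤-antisym (lower p) (lower q))
  }

module _ {𝓤 𝓣 : Level} where
  open Poset (𝟚-poset 𝓤 𝓣)

  𝟚-nontrivial : Nontrivial (𝟚-poset 𝓤 𝓣)
  𝟚-nontrivial = lift false , lift true , lift f≤t , λ ()

  𝟚-locallySmall : ∀ 𝓥 → locallySmall (𝟚-poset 𝓤 𝓣) 𝓥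
  𝟚-locallySmall 𝓥 a b = Lift-isSmall 𝓥 (lower a ≤ lower b)

  𝟚-hasDecidableEquality : hasDecidableEquality (𝟚-poset 𝓤 𝓣)
  𝟚-hasDecidableEquality a b = map′ (cong lift) (cong lower) (lower a ≟ lower b)

  _𝟚⊑?_ : ∀ a b → Dec (a ⊑ b)
  a 𝟚⊑? b = map′ lift lower (lower a ≤? lower b)

mainTheorem2 : (𝓥 𝓤 𝓣 : Level) → NTLSδDecPoset 𝓥 𝓤 𝓣 ⇔ WEM 𝓥
mainTheorem2 𝓥 𝓤 𝓣 = mk⇔ to from
  where
  to : NTLSδDecPoset 𝓥 𝓤 𝓣 → WEM 𝓥
  to (X , (x , y , x⊑y , x≢y) , _ , complete , _≟X_) =
    δ-complete⇒WEM X _≟X_ complete x y x⊑y x≢y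

  from : WEM 𝓥 → NTLSδDecPoset 𝓥 𝓤 𝓣
  from wem = 𝟚-poset 𝓤 𝓣 , 𝟚-nontrivial , 𝟚-locallySmall 𝓥
           , WEM⇒δ-complete (𝟚-poset 𝓤 𝓣) _𝟚⊑?_ wem , 𝟚-hasDecidableEquality {𝓤} {𝓣}
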